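{- Let $\mathcal{H}$ be an $r\times n$ matrix over $\mathbb{F}_2$ with $r\le n$, rank $r$, and all columns nonzero, and let $S\subseteq\mathbb{Z}_2^r$ be the set of columns of $\mathcal{H}$. If no column of $\mathcal{H}$ equals the sum of two columns of $\mathcal{H}$, then the Cayley graph $X=\mathrm{Cay}(\mathbb{Z}_2^r,S)$ has optimal fault-tolerance, i.e. $\kappa(X)=\delta(X)$.
   Context: $\mathrm{Cay}(\mathbb{Z}_2^r,S)$ has vertex set $\mathbb{Z}_2^r$ (binary vectors of length $r$), with $x,y$ adjacent iff $x+y\in S$ (componentwise mod $2$). $\kappa(X)$ is the vertex-connectivity (minimum number of vertices whose removal leaves a disconnected graph or a single vertex) and $\delta(X)$ the minimum degree. -}

module Defs where

open import Data.Bool using (Bool; true; false; _xor_)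
open import Data.Nat using (ℕ; zero; suc; _≤_; _⊓_)
open import Data.Fin using (Fin)
open import Data.Fin.Properties using (any?)
open import Data.Vec using (Vec; []; _∷_; zipWith; replicate)
open import Data.Vec.Properties using (≡-dec)
open import Data.List using (List; []; _∷_; map; _++_; filter; length; foldr)
open import Data.Product using (Σ; ∃; ∃-syntax; _×_; _,_)
open import Data.Sum using (_⊎_)
open import Relation.Nullary using (¬_; Dec)
open import Relation.Binary.PropositionalEquality using (_≡_; _≢_)
import Data.Bool.Properties as BP

V : ℕ → Set
V r = Vec Bool r

_⊕_ : ∀ {r} → V r → V r → V r
_⊕_ = zipWith _xor_

𝟘 : ∀ {r} → V r
𝟘 = replicate _ false

_≟V_ : ∀ {r} (x y : V r) → Dec (x ≡ y)
_≟V_ = ≡-dec BP._≟_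

-- An r × n matrix over F_2 given by its columns.
Matrix : ℕ → ℕ → Set
Matrix r n = Fin n → V r

lincomb : ∀ {r n} → Matrix r n → (Fin n → Bool) → V r
lincomb {n = zero}  H c = 𝟘
lincomb {n = suc n} H c with c Fin.zero
... | true  = H Fin.zero ⊕ lincomb (λ i → H (Fin.suc i)) (λ i → c (Fin.suc i))
... | false = lincomb (λ i → H (Fin.suc i)) (λ i → c (Fin.suc i))

-- rank H = r for an r × n matrix: the column space is all of F_2^r.
HasFullRowRank : ∀ {r n} → Matrix r n → Set
HasFullRowRank {r} {n} H = ∀ (x : V r) → ∃[ c ] (lincomb H c ≡ x)

_∈S_ : ∀ {r n} → V r → Matrix r n → Set
x ∈S H = ∃[ i ] (x ≡ H i)

_∈S?_ : ∀ {r n} (x : V r) (H : Matrix r n) → Dec (x ∈S H)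
x ∈S? H = any? (λ i → x ≟V H i)

Adj : ∀ {r n} → Matrix r n → V r → V r → Set
Adj H x y = (x ⊕ y) ∈S H

Adj? : ∀ {r n} (H : Matrix r n) (x y : V r) → Dec (Adj H x y)
Adj? H x y = (x ⊕ y) ∈S? H

allV : (r : ℕ) → List (V r)
allV zero    = [] ∷ []
allV (suc r) = map (true ∷_) (allV r) ++ map (false ∷_) (allV r)

degree : ∀ {r n} → Matrix r n → V r → ℕ
degree {r} H x = length (filter (Adj? H x) (allV r))

minDegree : ∀ {r n} → Matrix r n → ℕ
minDegree {r} H = foldr (λ x m → degree H x ⊓ m) (degree H 𝟘) (allV r)

VSet : ℕ → Set
VSet r = V r → Bool

size : ∀ {r} → VSet r → ℕ
size {r} C = length (filter (λ x → C x BP.≟ true) (allV r))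

remaining : ∀ {r} → VSet r → ℕ
remaining {r} C = length (filter (λ x → C x BP.≟ false) (allV r))

data Reach {r n} (H : Matrix r n) (C : VSet r) : V r → V r → Set where
  here : ∀ {x} → C x ≡ false → Reach H C x x
  step : ∀ {x y z} → C x ≡ false → Adj H x y → Reach H C y z → Reach H C x z

Disconnected : ∀ {r n} → Matrix r n → VSet r → Set
Disconnected H C = ∃[ x ] ∃[ y ] (C x ≡ false × C y ≡ false × ¬ Reach H C x y)

-- C is a vertex cut in the generalised sense of the definition of κ:
-- removing C leaves a disconnected graph or a single vertex.
IsCut : ∀ {r n} → Matrix r n → VSet r → Set
IsCut H C = Disconnected H C ⊎ remaining C ≡ 1

IsVertexConnectivity : ∀ {r n} → Matrix r n → ℕ → Set
IsVertexConnectivity {r} H k =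
  (∃[ C ] (IsCut H C × size C ≡ k)) × (∀ (C : VSet r) → IsCut H C → k ≤ size C)

module Submission where

open import Defs
open import Algebra.Bundles using (CommutativeSemigroup)
open import Data.Bool using (Bool; true; false; not; _∧_; _∨_; _xor_)
import Data.Bool.Properties as Bool
open import Data.Nat using (ℕ; zero; suc; _+_; _≤_; _<_; z≤n; s≤s; _⊓_; _≤?_)
open import Data.Nat.Properties
open import Algebra.Properties.CommutativeSemigroup +-commutativeSemigroup using (interchange)
open import Data.Fin as Fin using (Fin)
open import Data.Fin.Properties using (any?)
open import Data.Vec using ([]; _∷_)
open import Data.Vec.Properties using (zipWith-comm; zipWith-assoc; zipWith-identityˡ)
open import Data.List using (List; []; _∷_; map; _++_; filter; length; foldr)
open import Data.List.Membership.Propositional using (_∈_)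
open import Data.List.Membership.Propositional.Properties using (∈-map⁺; ∈-++⁺ˡ; ∈-++⁺ʳ)
open import Data.List.Relation.Unary.Any as Any using (here; there)
open import Data.Product using (∃; ∃-syntax; _×_; _,_; proj₁; proj₂)
open import Data.Sum using (_⊎_; inj₁; inj₂)
open import Function using (_∘_)
open import Relation.Nullary using (Dec; yes; no; does; contradiction)
open import Relation.Nullary.Decidable using (dec-true; dec-false; _×-dec_)
open import Relation.Binary.PropositionalEquality

-- The Cayley graph is vertex-transitive of degree d = |S|, and N(0) = S is a cut, so κ ≤ δ = d.
-- Conversely, if C disconnects x from y, the component A of x in X − C is a fragment: a
-- nonempty set with a vertex outside A ∪ N(A), whose boundary ∂A = N(A) ∖ A lies in C.  We show
-- |∂A| ≥ d for every fragment by induction on (|∂A|, |A|).  If A is closed under x + y + z it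
-- is a coset of a subgroup K; full rank gives a column u ∉ K, and S embeds into ∂K via s ↦ s on
-- S ∖ K and s ↦ u + s on S ∩ K.  Otherwise a₁ + a₂ + a₃ ∉ A for some aᵢ ∈ A; with the translate
-- A′ = a₁ + a₂ + A, submodularity |∂(A ∩ A′)| + |∂(A ∪ A′)| ≤ 2|∂A| yields a fragment that is
-- smaller in the lexicographic order: A ∩ A′, A ∪ A′, or, if A ∪ A′ has no exterior, the
-- exterior of A.

bit : Bool → ℕ
bit true  = 1
bit false = 0

bit-mono : ∀ {a b} → (a ≡ true → b ≡ true) → bit a ≤ bit b
bit-mono {false} h = z≤n
bit-mono {true}  h rewrite h refl = ≤-refl

⇔→≡ : ∀ {a b} → (a ≡ true → b ≡ true) → (b ≡ true → a ≡ true) → a ≡ b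
⇔→≡ {false} {false} _   _   = refl
⇔→≡ {false} {true}  _   b→a = b→a refl
⇔→≡ {true}          a→b _   = sym (a→b refl)

contraposeᵇ : ∀ {a b} → (a ≡ true → b ≡ true) → b ≡ false → a ≡ false
contraposeᵇ {false} _ _  = refl
contraposeᵇ {true}  h bf = trans (sym (h refl)) bf

from-does : ∀ {P : Set} (P? : Dec P) → does P? ≡ true → P
from-does (yes p) _ = p

does-≟-true : ∀ b → does (b Bool.≟ true) ≡ b
does-≟-true false = refl
does-≟-true true  = refl

does-≟-false : ∀ b → does (b Bool.≟ false) ≡ not b
does-≟-false false = refl
does-≟-false true  = refl

-- Counting

module _ {A : Set} where

  count : (A → Bool) → List A → ℕ
  count f []       = 0
  count f (x ∷ xs) = bit (f x) + count f xs

  count-cong : ∀ {f g} → f ≗ g → ∀ xs → count f xs ≡ count g xs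
  count-cong f≗g []       = refl
  count-cong f≗g (x ∷ xs) = cong₂ _+_ (cong bit (f≗g x)) (count-cong f≗g xs)

  count-mono : ∀ {f g} → (∀ x → f x ≡ true → g x ≡ true) → ∀ xs → count f xs ≤ count g xs
  count-mono f⊆g []       = z≤n
  count-mono f⊆g (x ∷ xs) = +-mono-≤ (bit-mono (f⊆g x)) (count-mono f⊆g xs)

  count-mono-< : ∀ {f g} → (∀ x → f x ≡ true → g x ≡ true) →
                 ∀ {xs y} → y ∈ xs → f y ≡ false → g y ≡ true → count f xs < count g xs
  count-mono-< f⊆g {x ∷ xs} (here refl) fy gy rewrite fy | gy = s≤s (count-mono f⊆g xs)
  count-mono-< f⊆g {x ∷ xs} (there y∈xs) fy gy =
    +-mono-≤-< (bit-mono (f⊆g x)) (count-mono-< f⊆g y∈xs fy gy)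

  count-mono₂ : ∀ {f₁ f₂ g₁ g₂} → (∀ x → bit (f₁ x) + bit (f₂ x) ≤ bit (g₁ x) + bit (g₂ x)) →
                ∀ xs → count f₁ xs + count f₂ xs ≤ count g₁ xs + count g₂ xs
  count-mono₂ h []       = z≤n
  count-mono₂ {f₁} {f₂} {g₁} {g₂} h (x ∷ xs) =
    subst₂ _≤_ (interchange (bit (f₁ x)) (bit (f₂ x)) (count f₁ xs) (count f₂ xs))
               (interchange (bit (g₁ x)) (bit (g₂ x)) (count g₁ xs) (count g₂ xs))
               (+-mono-≤ (h x) (count-mono₂ h xs))

  count-split : ∀ (f g : A → Bool) xs →
                count f xs ≡ count (λ x → f x ∧ g x) xs + count (λ x → f x ∧ not (g x)) xs
  count-split f g []       = refl
  count-split f g (x ∷ xs) =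
    trans (cong₂ _+_ (bit-split (f x) (g x)) (count-split f g xs))
          (interchange (bit (f x ∧ g x)) (bit (f x ∧ not (g x))) _ _)
    where
    bit-split : ∀ a b → bit a ≡ bit (a ∧ b) + bit (a ∧ not b)
    bit-split false b     = refl
    bit-split true  false = refl
    bit-split true  true  = refl

  count-true : ∀ xs → count (λ _ → true) xs ≡ length xs
  count-true []       = refl
  count-true (x ∷ xs) = cong suc (count-true xs)

  count-false : ∀ xs → count (λ _ → false) xs ≡ 0
  count-false []       = refl
  count-false (x ∷ xs) = count-false xs

  count-≤-length : ∀ (f : A → Bool) xs → count f xs ≤ length xs
  count-≤-length f xs = subst (count f xs ≤_) (count-true xs) (count-mono (λ _ _ → refl) xs)

  count-++ : ∀ (f : A → Bool) xs ys → count f (xs ++ ys) ≡ count f xs + count f ys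
  count-++ f []       ys = refl
  count-++ f (x ∷ xs) ys rewrite count-++ f xs ys = sym (+-assoc (bit (f x)) _ _)

  length-filter≡count : ∀ {P : A → Set} (P? : ∀ x → Dec (P x)) xs →
                        length (filter P? xs) ≡ count (λ x → does (P? x)) xs
  length-filter≡count P? []       = refl
  length-filter≡count P? (x ∷ xs) with does (P? x)
  ... | true  = cong suc (length-filter≡count P? xs)
  ... | false = length-filter≡count P? xs

count-map : ∀ {A B : Set} (f : B → Bool) (g : A → B) xs → count f (map g xs) ≡ count (f ∘ g) xs
count-map f g []       = refl
count-map f g (x ∷ xs) = cong (bit (f (g x)) +_) (count-map f g xs)

-- The group ℤ₂ʳ

⊕-comm : ∀ {r} (x y : V r) → x ⊕ y ≡ y ⊕ x
⊕-comm = zipWith-comm Bool.xor-comm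

⊕-assoc : ∀ {r} (x y z : V r) → (x ⊕ y) ⊕ z ≡ x ⊕ (y ⊕ z)
⊕-assoc = zipWith-assoc Bool.xor-assoc

⊕-identityˡ : ∀ {r} (x : V r) → 𝟘 ⊕ x ≡ x
⊕-identityˡ = zipWith-identityˡ Bool.xor-identityˡ

⊕-identityʳ : ∀ {r} (x : V r) → x ⊕ 𝟘 ≡ x
⊕-identityʳ x = trans (⊕-comm x 𝟘) (⊕-identityˡ x)

⊕-self : ∀ {r} (x : V r) → x ⊕ x ≡ 𝟘
⊕-self []      = refl
⊕-self (a ∷ x) = cong₂ _∷_ (Bool.xor-same a) (⊕-self x)

⊕-cancelˡ : ∀ {r} (x y : V r) → x ⊕ (x ⊕ y) ≡ y
⊕-cancelˡ x y = begin
  x ⊕ (x ⊕ y) ≡⟨ ⊕-assoc x x y ⟨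
  (x ⊕ x) ⊕ y ≡⟨ cong (_⊕ y) (⊕-self x) ⟩
  𝟘 ⊕ y       ≡⟨ ⊕-identityˡ y ⟩
  y           ∎
  where open ≡-Reasoning

⊕-cancelʳ : ∀ {r} (x y : V r) → (y ⊕ x) ⊕ x ≡ y
⊕-cancelʳ x y = trans (cong (_⊕ x) (⊕-comm y x)) (trans (⊕-comm (x ⊕ y) x) (⊕-cancelˡ x y))

⊕-cancel-outer : ∀ {r} (x y : V r) → (x ⊕ y) ⊕ x ≡ y
⊕-cancel-outer x y = trans (cong (_⊕ x) (⊕-comm x y)) (⊕-cancelʳ x y)

⊕-commutativeSemigroup : ℕ → CommutativeSemigroup _ _
⊕-commutativeSemigroup r = record
  { Carrier = V r ; _≈_ = _≡_ ; _∙_ = _⊕_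
  ; isCommutativeSemigroup = record
    { isSemigroup = record
      { isMagma = record { isEquivalence = isEquivalence ; ∙-cong = cong₂ _⊕_ }
      ; assoc = ⊕-assoc }
    ; comm = ⊕-comm } }

-- Vertex sets

allV-complete : ∀ {r} (x : V r) → x ∈ allV r
allV-complete []                  = here refl
allV-complete {suc r} (true ∷ x)  = ∈-++⁺ˡ (∈-map⁺ (true ∷_) (allV-complete x))
allV-complete {suc r} (false ∷ x) = ∈-++⁺ʳ (map (true ∷_) (allV r)) (∈-map⁺ (false ∷_) (allV-complete x))

anyV? : ∀ {r} {P : V r → Set} → (∀ x → Dec (P x)) → Dec (∃ P)
anyV? {r} {P} P? with Any.any? P? (allV r)
... | yes p = yes (Any.satisfied p)
... | no ¬p = no λ (x , px) → ¬p (Any.map (λ { refl → px }) (allV-complete x))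

infix  4 _⊆_
infixr 7 _∩_
infixr 6 _∪_

_⊆_ : ∀ {r} → VSet r → VSet r → Set
A ⊆ B = ∀ x → A x ≡ true → B x ≡ true

_∩_ _∪_ : ∀ {r} → VSet r → VSet r → VSet r
(A ∩ B) x = A x ∧ B x
(A ∪ B) x = A x ∨ B x

∩-intro : ∀ {r} (A B : VSet r) {x} → A x ≡ true → B x ≡ true → (A ∩ B) x ≡ true
∩-intro A B Ax Bx rewrite Ax = Bx

∣_∣ : ∀ {r} → VSet r → ℕ
∣ A ∣ = count A (allV _)

∣V∣ : ℕ → ℕ
∣V∣ r = length (allV r)

size≡∣∣ : ∀ {r} (C : VSet r) → size C ≡ ∣ C ∣
size≡∣∣ {r} C = trans (length-filter≡count _ (allV r)) (count-cong (does-≟-true ∘ C) (allV r))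

remaining≡∣not∣ : ∀ {r} (C : VSet r) → remaining C ≡ ∣ not ∘ C ∣
remaining≡∣not∣ {r} C = trans (length-filter≡count _ (allV r)) (count-cong (does-≟-false ∘ C) (allV r))

∣∣-complement : ∀ {r} (A : VSet r) → ∣ A ∣ + ∣ not ∘ A ∣ ≡ ∣V∣ r
∣∣-complement {r} A = trans (sym (count-split (λ _ → true) A (allV r))) (count-true (allV r))

∣∪∣≤ : ∀ {r} (A B : VSet r) → ∣ A ∪ B ∣ ≤ ∣ A ∣ + ∣ B ∣
∣∪∣≤ {r} A B = begin
  ∣ A ∪ B ∣                                  ≡⟨ count-split (A ∪ B) A (allV r) ⟩
  ∣ (A ∪ B) ∩ A ∣ + ∣ (A ∪ B) ∩ (not ∘ A) ∣ ≤⟨ +-mono-≤ (count-mono left (allV r))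
                                                          (count-mono right (allV r)) ⟩
  ∣ A ∣ + ∣ B ∣                              ∎
  where
  open ≤-Reasoning
  left : (A ∪ B) ∩ A ⊆ A
  left x = Bool.∧-conicalʳ (A x ∨ B x) (A x)
  right : (A ∪ B) ∩ (not ∘ A) ⊆ B
  right x with A x
  ... | false = Bool.∧-conicalˡ (B x) true

∣∣-cons : ∀ {r} (A : VSet (suc r)) → ∣ A ∣ ≡ ∣ A ∘ (true ∷_) ∣ + ∣ A ∘ (false ∷_) ∣
∣∣-cons {r} A = trans (count-++ A (map (true ∷_) (allV r)) _)
                      (cong₂ _+_ (count-map A (true ∷_) (allV r)) (count-map A (false ∷_) (allV r)))

∣∣-translate : ∀ {r} (t : V r) (A : VSet r) → ∣ A ∘ (t ⊕_) ∣ ≡ ∣ A ∣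
∣∣-translate []      A = refl
∣∣-translate (b ∷ t) A = begin
  ∣ A ∘ ((b ∷ t) ⊕_) ∣
    ≡⟨ ∣∣-cons (A ∘ ((b ∷ t) ⊕_)) ⟩
  ∣ A ∘ ((b xor true) ∷_) ∘ (t ⊕_) ∣ + ∣ A ∘ ((b xor false) ∷_) ∘ (t ⊕_) ∣
    ≡⟨ cong₂ _+_ (∣∣-translate t (A ∘ ((b xor true) ∷_))) (∣∣-translate t (A ∘ ((b xor false) ∷_))) ⟩
  ∣ A ∘ ((b xor true) ∷_) ∣ + ∣ A ∘ ((b xor false) ∷_) ∣
    ≡⟨ swap-halves b ⟩
  ∣ A ∘ (true ∷_) ∣ + ∣ A ∘ (false ∷_) ∣
    ≡⟨ ∣∣-cons A ⟨
  ∣ A ∣ ∎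
  where
  open ≡-Reasoning
  swap-halves : ∀ b → ∣ A ∘ ((b xor true) ∷_) ∣ + ∣ A ∘ ((b xor false) ∷_) ∣
                    ≡ ∣ A ∘ (true ∷_) ∣ + ∣ A ∘ (false ∷_) ∣
  swap-halves true  = +-comm ∣ A ∘ (false ∷_) ∣ ∣ A ∘ (true ∷_) ∣
  swap-halves false = refl

isZero : ∀ {r} → VSet r
isZero y = does (y ≟V 𝟘)

∣isZero∣ : ∀ r → ∣ isZero {r} ∣ ≡ 1
∣isZero∣ zero    = refl
∣isZero∣ (suc r) = trans (∣∣-cons (isZero {suc r})) (cong₂ _+_ (count-false (allV r)) (∣isZero∣ r))

increasing-stabilises : ∀ {r} (R : ℕ → VSet r) → (∀ k → R k ⊆ R (suc k)) → ∃[ j ] R (suc j) ⊆ R j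
increasing-stabilises {r} R R-incr with grows (suc (∣V∣ r))
  where
  grows : ∀ k → (∃[ j ] R (suc j) ⊆ R j) ⊎ k ≤ ∣ R k ∣
  grows zero = inj₂ z≤n
  grows (suc k) with grows k
  ... | inj₁ stable = inj₁ stable
  ... | inj₂ k≤∣Rk∣ with anyV? (λ z → (R (suc k) z Bool.≟ true) ×-dec (R k z Bool.≟ false))
  ...   | yes (z , new , old) =
          inj₂ (≤-<-trans k≤∣Rk∣ (count-mono-< (R-incr k) (allV-complete z) old new))
  ...   | no ¬new = inj₁ (k , λ z z∈Rk+1 → Bool.¬-not λ z∉Rk → ¬new (z , z∈Rk+1 , z∉Rk))
... | inj₁ stable  = stable
... | inj₂ too-big = contradiction (count-≤-length (R _) (allV r)) (<⇒≱ too-big)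

AffinelyClosed AdditivelyClosed : ∀ {r} → VSet r → Set
AffinelyClosed A = ∀ a b c → A a ≡ true → A b ≡ true → A c ≡ true → A ((a ⊕ b) ⊕ c) ≡ true
AdditivelyClosed B = ∀ x y → B x ≡ true → B y ≡ true → B (x ⊕ y) ≡ true

NonAffineTriple : ∀ {r} → VSet r → Set
NonAffineTriple A = ∃[ a₁ ] ∃[ a₂ ] ∃[ a₃ ]
  (A a₁ ≡ true × A a₂ ≡ true × A a₃ ≡ true × A ((a₁ ⊕ a₂) ⊕ a₃) ≡ false)

affinelyClosed-or-nonAffineTriple : ∀ {r} (A : VSet r) → AffinelyClosed A ⊎ NonAffineTriple A
affinelyClosed-or-nonAffineTriple A
  with anyV? (λ a₁ → anyV? (λ a₂ → anyV? (λ a₃ →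
         (A a₁ Bool.≟ true) ×-dec (A a₂ Bool.≟ true) ×-dec (A a₃ Bool.≟ true) ×-dec
         (A ((a₁ ⊕ a₂) ⊕ a₃) Bool.≟ false))))
... | yes triple = inj₂ triple
... | no ¬triple = inj₁ λ a₁ a₂ a₃ A₁ A₂ A₃ →
                     Bool.¬-not λ A₁₂₃ → ¬triple (a₁ , a₂ , a₃ , A₁ , A₂ , A₃ , A₁₂₃)

affine-translate-additive : ∀ {r} {A : VSet r} {a} → AffinelyClosed A → A a ≡ true →
                            AdditivelyClosed (A ∘ (a ⊕_))
affine-translate-additive {r} {A} {a} closed Aa x y Bx By =
  subst (λ z → A z ≡ true) translate-back (closed a (a ⊕ x) (a ⊕ y) Aa Bx By)
  where
  open import Algebra.Properties.CommutativeSemigroup (⊕-commutativeSemigroup r) using (x∙yz≈y∙xz)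
  translate-back : (a ⊕ (a ⊕ x)) ⊕ (a ⊕ y) ≡ a ⊕ (x ⊕ y)
  translate-back = trans (cong (_⊕ (a ⊕ y)) (⊕-cancelˡ a x)) (x∙yz≈y∙xz x a y)

lincomb-induction : ∀ {r n} (H : Matrix r n) (P : V r → Set) →
  P 𝟘 → (∀ i w → P w → P (H i ⊕ w)) → ∀ c → P (lincomb H c)
lincomb-induction {n = zero}  H P P𝟘 P-step c = P𝟘
lincomb-induction {n = suc n} H P P𝟘 P-step c with c Fin.zero
... | true  = P-step Fin.zero _ (lincomb-induction (H ∘ Fin.suc) P P𝟘 (P-step ∘ Fin.suc) (c ∘ Fin.suc))
... | false = lincomb-induction (H ∘ Fin.suc) P P𝟘 (P-step ∘ Fin.suc) (c ∘ Fin.suc)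

lexicographic-induction : ∀ {X : Set} (P : X → Set) (μ ν : X → ℕ) →
  (∀ x → (∀ y → μ y < μ x → P y) → (∀ y → μ y ≤ μ x → ν y < ν x → P y) → P x) →
  ∀ x → P x
lexicographic-induction {X} P μ ν build x = go (suc (μ x)) (suc (ν x)) x ≤-refl ≤-refl
  where
  go : ∀ m k x → μ x < m → ν x < k → P x
  go (suc m) (suc k) x (s≤s μx≤m) (s≤s νx≤k) = build x
    (λ y μy<μx → go m (suc (ν y)) y (<-≤-trans μy<μx μx≤m) ≤-refl)
    (λ y μy≤μx νy<νx → go (suc m) k y (s≤s (≤-trans μy≤μx μx≤m)) (<-≤-trans νy<νx νx≤k))

reach-snoc : ∀ {r n} {H : Matrix r n} {C a b c} →
             Reach H C a b → Adj H b c → C c ≡ false → Reach H C a c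
reach-snoc (here a∉C)           b~c c∉C = step a∉C b~c (here c∉C)
reach-snoc (step a∉C a~a′ a′⇝b) b~c c∉C = step a∉C a~a′ (reach-snoc a′⇝b b~c c∉C)

-- Boundaries in Cay(ℤ₂ʳ, S)

module CayleyGraph {r n : ℕ} (H : Matrix r n) where

  inS : VSet r
  inS v = does (v ∈S? H)

  d : ℕ
  d = ∣ inS ∣

  SumFree : Set
  SumFree = ∀ i j k → H k ≢ (H i ⊕ H j)

  inS-intro : ∀ {v} i → v ≡ H i → inS v ≡ true
  inS-intro i v≡Hi = dec-true (_ ∈S? H) (i , v≡Hi)

  inS-elim : ∀ {v} → inS v ≡ true → v ∈S H
  inS-elim = from-does (_ ∈S? H)

  nbhd ∂ ext : VSet r → VSet r
  nbhd A x = does (any? λ i → A (x ⊕ H i) Bool.≟ true)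
  ∂ A x = not (A x) ∧ nbhd A x
  ext A x = not (A x) ∧ not (nbhd A x)

  Fragment : VSet r → Set
  Fragment A = (∃[ a ] A a ≡ true) × (∃[ c ] ext A c ≡ true)

  nbhd-intro : ∀ A {x} i → A (x ⊕ H i) ≡ true → nbhd A x ≡ true
  nbhd-intro A i e = dec-true (any? _) (i , e)

  nbhd-elim : ∀ A {x} → nbhd A x ≡ true → ∃[ i ] A (x ⊕ H i) ≡ true
  nbhd-elim A e = from-does (any? _) e

  nbhd-symmetric : ∀ A {x} i → A x ≡ true → nbhd A (x ⊕ H i) ≡ true
  nbhd-symmetric A {x} i e = nbhd-intro A i (subst (λ z → A z ≡ true) (sym (⊕-cancelʳ (H i) x)) e)

  nbhd-mono : ∀ {A B} → A ⊆ B → nbhd A ⊆ nbhd B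
  nbhd-mono {A} {B} A⊆B x e with nbhd-elim A e
  ... | i , p = nbhd-intro B i (A⊆B _ p)

  ∂-intro : ∀ A {x} → A x ≡ false → nbhd A x ≡ true → ∂ A x ≡ true
  ∂-intro A Ax nAx rewrite Ax = nAx

  ∂-elim : ∀ A {x} → ∂ A x ≡ true → A x ≡ false × nbhd A x ≡ true
  ∂-elim A {x} e with A x | nbhd A x
  ... | false | true = refl , refl

  ext-intro : ∀ A {x} → A x ≡ false → nbhd A x ≡ false → ext A x ≡ true
  ext-intro A Ax nAx rewrite Ax | nAx = refl

  ext-elim : ∀ A {x} → ext A x ≡ true → A x ≡ false × nbhd A x ≡ false
  ext-elim A {x} e with A x | nbhd A x
  ... | false | false = refl , refl

  ext-antitone : ∀ {A B} → A ⊆ B → ext B ⊆ ext A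
  ext-antitone {A} {B} A⊆B x e with ext-elim B e
  ... | Bx , nBx = ext-intro A (contraposeᵇ (A⊆B x) Bx) (contraposeᵇ (nbhd-mono A⊆B x) nBx)

  ∣∣-partition : ∀ A → ∣ A ∣ + (∣ ∂ A ∣ + ∣ ext A ∣) ≡ ∣V∣ r
  ∣∣-partition A = trans (cong (∣ A ∣ +_) (sym (count-split (not ∘ A) (nbhd A) (allV r))))
                         (∣∣-complement A)

  ∂-translate : ∀ (t : V r) A → ∂ (A ∘ (t ⊕_)) ≗ ∂ A ∘ (t ⊕_)
  ∂-translate t A x = cong (not (A (t ⊕ x)) ∧_) (⇔→≡ to from)
    where
    to : nbhd (A ∘ (t ⊕_)) x ≡ true → nbhd A (t ⊕ x) ≡ true
    to e with nbhd-elim (A ∘ (t ⊕_)) e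
    ... | i , p = nbhd-intro A i (subst (λ z → A z ≡ true) (sym (⊕-assoc t x (H i))) p)
    from : nbhd A (t ⊕ x) ≡ true → nbhd (A ∘ (t ⊕_)) x ≡ true
    from e with nbhd-elim A e
    ... | i , p = nbhd-intro (A ∘ (t ⊕_)) i (subst (λ z → A z ≡ true) (⊕-assoc t x (H i)) p)

  ∣∂∣-translate : ∀ (t : V r) A → ∣ ∂ (A ∘ (t ⊕_)) ∣ ≡ ∣ ∂ A ∣
  ∣∂∣-translate t A = trans (count-cong (∂-translate t A) (allV r)) (∣∣-translate t (∂ A))

  ∂-submodular : ∀ A B → ∣ ∂ (A ∩ B) ∣ + ∣ ∂ (A ∪ B) ∣ ≤ ∣ ∂ A ∣ + ∣ ∂ B ∣
  ∂-submodular A B = count-mono₂ (λ x → bits (A x) (B x) (nbhd-∩ x) (nbhd-∪ x)) (allV r)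
    where
    nbhd-∩ : ∀ x → nbhd (A ∩ B) x ≡ true → nbhd A x ≡ true × nbhd B x ≡ true
    nbhd-∩ x e = nbhd-mono (λ y → Bool.∧-conicalˡ (A y) (B y)) x e
               , nbhd-mono (λ y → Bool.∧-conicalʳ (A y) (B y)) x e
    nbhd-∪ : ∀ x → nbhd (A ∪ B) x ≡ true → nbhd A x ∨ nbhd B x ≡ true
    nbhd-∪ x e with nbhd-elim (A ∪ B) e
    ... | i , p with A (x ⊕ H i) in Ay
    ...   | true  rewrite nbhd-intro A i Ay = refl
    ...   | false rewrite nbhd-intro B i p  = Bool.∨-zeroʳ (nbhd A x)
    bits : ∀ a b {p q pI pU} → (pI ≡ true → p ≡ true × q ≡ true) → (pU ≡ true → p ∨ q ≡ true) →
           bit (not (a ∧ b) ∧ pI) + bit (not (a ∨ b) ∧ pU) ≤ bit (not a ∧ p) + bit (not b ∧ q)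
    bits true  true  hI hU = z≤n
    bits true  false {q = q} hI hU =
      subst (_ ≤_) (+-identityʳ (bit q)) (+-monoˡ-≤ 0 (bit-mono (proj₂ ∘ hI)))
    bits false true  hI hU = +-monoˡ-≤ 0 (bit-mono (proj₁ ∘ hI))
    bits false false {pI = true} {pU} hI hU rewrite proj₁ (hI refl) | proj₂ (hI refl) =
      s≤s (bit-mono {pU} λ _ → refl)
    bits false false {pI = false} {false} hI hU = z≤n
    bits false false {p = true}  {pI = false} {true} hI hU = s≤s z≤n
    bits false false {p = false} {pI = false} {true} hI hU rewrite hU refl = ≤-refl

  ∂-ext⊆∂ : ∀ A → ∂ (ext A) ⊆ ∂ A
  ∂-ext⊆∂ A z e with ∂-elim (ext A) e
  ... | z∉extA , z∈nbhd-extA with nbhd-elim (ext A) z∈nbhd-extA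
  ...   | i , z⊕Hi∈extA =
          ∂-intro A z∉A (Bool.¬-not λ z∉nbhdA → Bool.not-¬ z∉extA (ext-intro A z∉A z∉nbhdA))
    where
    z∉A : A z ≡ false
    z∉A = Bool.¬-not λ z∈A → Bool.not-¬ (proj₂ (ext-elim A z⊕Hi∈extA)) (nbhd-symmetric A i z∈A)

  ext-fragment : ∀ {A} → Fragment A → Fragment (ext A)
  ext-fragment {A} ((a , a∈A) , outside) = outside , (a , ext-intro (ext A) a∉extA a∉nbhd-extA)
    where
    a∉extA : ext A a ≡ false
    a∉extA rewrite a∈A = refl
    a∉nbhd-extA : nbhd (ext A) a ≡ false
    a∉nbhd-extA = Bool.¬-not λ e →
      let i , p = nbhd-elim (ext A) e in Bool.not-¬ (proj₂ (ext-elim A p)) (nbhd-symmetric A i a∈A)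

  additive-spanning : HasFullRowRank H → ∀ {B} → AdditivelyClosed B → B 𝟘 ≡ true →
                      (∀ i → B (H i) ≡ true) → ∀ x → B x ≡ true
  additive-spanning FR {B} add B𝟘 BH x with FR x
  ... | c , refl = lincomb-induction H (λ w → B w ≡ true) B𝟘 (λ i w → add (H i) w (BH i)) c

  -- S ∖ B lies in ∂B ∩ S, and s ↦ u + s maps S ∩ B into ∂B ∖ S, by sum-freeness.
  additive-∂-bound : SumFree → ∀ {B} → AdditivelyClosed B → B 𝟘 ≡ true →
                     ∀ {iu} → B (H iu) ≡ false → d ≤ ∣ ∂ B ∣
  additive-∂-bound SF {B} add B𝟘 {iu} u∉B = begin
    d                                             ≡⟨ count-split inS B (allV r) ⟩
    ∣ inS ∩ B ∣ + ∣ inS ∩ (not ∘ B) ∣             ≡⟨ cong (_+ _) (∣∣-translate u (inS ∩ B)) ⟨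
    ∣ (inS ∩ B) ∘ (u ⊕_) ∣ + ∣ inS ∩ (not ∘ B) ∣  ≤⟨ +-mono-≤ (count-mono shifted (allV r))
                                                                 (count-mono direct (allV r)) ⟩
    ∣ ∂ B ∩ (not ∘ inS) ∣ + ∣ ∂ B ∩ inS ∣         ≡⟨ +-comm ∣ ∂ B ∩ (not ∘ inS) ∣ ∣ ∂ B ∩ inS ∣ ⟩
    ∣ ∂ B ∩ inS ∣ + ∣ ∂ B ∩ (not ∘ inS) ∣         ≡⟨ count-split (∂ B) inS (allV r) ⟨
    ∣ ∂ B ∣                                       ∎
    where
    open ≤-Reasoning
    u = H iu
    direct : inS ∩ (not ∘ B) ⊆ ∂ B ∩ inS
    direct s e with inS-elim (Bool.∧-conicalˡ (inS s) _ e)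
    ... | i , refl = ∩-intro (∂ B) inS (∂-intro B s∉B (nbhd-intro B i s⊕s∈B)) (Bool.∧-conicalˡ _ _ e)
      where
      s∉B = Bool.not-injective {y = false} (Bool.∧-conicalʳ (inS s) _ e)
      s⊕s∈B = subst (λ z → B z ≡ true) (sym (⊕-self (H i))) B𝟘
    shifted : (inS ∩ B) ∘ (u ⊕_) ⊆ ∂ B ∩ (not ∘ inS)
    shifted x e = ∩-intro (∂ B) (not ∘ inS) (∂-intro B x∉B (nbhd-intro B iu x⊕u∈B)) (cong not x∉S)
      where
      u⊕x∈S = Bool.∧-conicalˡ (inS (u ⊕ x)) _ e
      u⊕x∈B = Bool.∧-conicalʳ (inS (u ⊕ x)) _ e
      x⊕u∈B : B (x ⊕ u) ≡ true
      x⊕u∈B = subst (λ z → B z ≡ true) (⊕-comm u x) u⊕x∈B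
      x∉B : B x ≡ false
      x∉B = Bool.¬-not λ x∈B →
        Bool.not-¬ u∉B (subst (λ z → B z ≡ true) (⊕-cancelʳ x u) (add (u ⊕ x) x u⊕x∈B x∈B))
      x∉S : inS x ≡ false
      x∉S = Bool.¬-not λ x∈S →
        let k , x≡Hk = inS-elim x∈S ; i , u⊕x≡Hi = inS-elim u⊕x∈S in
        SF i iu k (trans (sym x≡Hk) (trans (sym (⊕-cancel-outer u x)) (cong (_⊕ u) u⊕x≡Hi)))

  affine-fragment-bound : HasFullRowRank H → SumFree → ∀ {A} → AffinelyClosed A → Fragment A →
                          d ≤ ∣ ∂ A ∣
  affine-fragment-bound FR SF {A} closed ((a , a∈A) , (c , c∈extA)) =
    subst (d ≤_) (∣∂∣-translate a A) (bound (any? (λ i → B (H i) Bool.≟ false)))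
    where
    B = A ∘ (a ⊕_)
    B-add : AdditivelyClosed B
    B-add = affine-translate-additive closed a∈A
    𝟘∈B : B 𝟘 ≡ true
    𝟘∈B = subst (λ z → A z ≡ true) (sym (⊕-identityʳ a)) a∈A
    bound : Dec (∃[ i ] B (H i) ≡ false) → d ≤ ∣ ∂ B ∣
    bound (yes (_ , u∉B)) = additive-∂-bound SF B-add 𝟘∈B u∉B
    bound (no ¬u) = contradiction c∈A (Bool.not-¬ (proj₁ (ext-elim A c∈extA)))
      where
      c∈A : A c ≡ true
      c∈A = subst (λ z → A z ≡ true) (⊕-cancelˡ a c)
              (additive-spanning FR B-add 𝟘∈B (λ i → Bool.¬-not (¬u ∘ (i ,_))) (a ⊕ c))

  FragmentBound : VSet r → Set
  FragmentBound A = Fragment A → d ≤ ∣ ∂ A ∣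

  nonaffine-fragment-step : ∀ {A} → NonAffineTriple A →
    (∀ B → ∣ ∂ B ∣ < ∣ ∂ A ∣ → FragmentBound B) →
    (∀ B → ∣ ∂ B ∣ ≤ ∣ ∂ A ∣ → ∣ B ∣ < ∣ A ∣ → FragmentBound B) →
    FragmentBound A
  nonaffine-fragment-step {A} (a₁ , a₂ , a₃ , A₁ , A₂ , A₃ , A₁₂₃) ih< ih≤ frag@(_ , (c , c∈extA)) =
    by-intersection (∣ ∂ I ∣ ≤? m)
    where
    m = ∣ ∂ A ∣
    s = ∣ A ∣
    A′ = A ∘ ((a₁ ⊕ a₂) ⊕_)
    I = A ∩ A′
    U = A ∪ A′

    submodular : ∣ ∂ I ∣ + ∣ ∂ U ∣ ≤ m + m
    submodular = subst (λ k → ∣ ∂ I ∣ + ∣ ∂ U ∣ ≤ m + k) (∣∂∣-translate (a₁ ⊕ a₂) A) (∂-submodular A A′)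

    I-fragment : Fragment I
    I-fragment = (a₁ , ∩-intro A A′ A₁ (subst (λ z → A z ≡ true) (sym (⊕-cancel-outer a₁ a₂)) A₂))
               , (c , ext-antitone (λ x → Bool.∧-conicalˡ (A x) (A′ x)) c c∈extA)

    ∣I∣<∣A∣ : ∣ I ∣ < s
    ∣I∣<∣A∣ = count-mono-< (λ x → Bool.∧-conicalˡ (A x) (A′ x)) (allV-complete a₃)
                (subst (λ b → b ∧ A′ a₃ ≡ false) (sym A₃) A₁₂₃) A₃

    ∣∂extA∣≤m : ∣ ∂ (ext A) ∣ ≤ m
    ∣∂extA∣≤m = count-mono (∂-ext⊆∂ A) (allV r)

    ∣extA∣<∣A∣ : ∣ ∂ U ∣ < m → (∀ x → ext U x ≢ true) → ∣ ext A ∣ < s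
    ∣extA∣<∣A∣ ∂U<m no-ext = +-cancelʳ-< m ∣ ext A ∣ s (+-cancelˡ-< s _ _ (begin-strict
      s + (∣ ext A ∣ + m)            ≡⟨ cong (s +_) (+-comm ∣ ext A ∣ m) ⟩
      s + (m + ∣ ext A ∣)            ≡⟨ ∣∣-partition A ⟩
      ∣V∣ r                          ≡⟨ ∣∣-partition U ⟨
      ∣ U ∣ + (∣ ∂ U ∣ + ∣ ext U ∣)  ≡⟨ cong (λ k → ∣ U ∣ + (∣ ∂ U ∣ + k)) ∣extU∣≡0 ⟩
      ∣ U ∣ + (∣ ∂ U ∣ + 0)          ≡⟨ cong (∣ U ∣ +_) (+-identityʳ ∣ ∂ U ∣) ⟩
      ∣ U ∣ + ∣ ∂ U ∣                ≤⟨ +-monoˡ-≤ ∣ ∂ U ∣ ∣U∣≤s+s ⟩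
      (s + s) + ∣ ∂ U ∣              <⟨ +-monoʳ-< (s + s) ∂U<m ⟩
      (s + s) + m                    ≡⟨ +-assoc s s m ⟩
      s + (s + m)                    ∎))
      where
      open ≤-Reasoning
      ∣extU∣≡0 : ∣ ext U ∣ ≡ 0
      ∣extU∣≡0 = trans (count-cong (λ x → Bool.¬-not (no-ext x)) (allV r)) (count-false (allV r))
      ∣U∣≤s+s : ∣ U ∣ ≤ s + s
      ∣U∣≤s+s = subst (λ k → ∣ U ∣ ≤ s + k) (∣∣-translate (a₁ ⊕ a₂) A) (∣∪∣≤ A A′)

    by-union : ∣ ∂ U ∣ < m → Dec (∃[ x ] ext U x ≡ true) → d ≤ m
    by-union ∂U<m (yes outside) =
      <⇒≤ (≤-<-trans (ih< U ∂U<m ((a₁ , cong (_∨ A′ a₁) A₁) , outside)) ∂U<m)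
    by-union ∂U<m (no no-outside) =
      ≤-trans (ih≤ (ext A) ∣∂extA∣≤m (∣extA∣<∣A∣ ∂U<m (λ x e → no-outside (x , e))) (ext-fragment frag))
              ∣∂extA∣≤m

    by-intersection : Dec (∣ ∂ I ∣ ≤ m) → d ≤ m
    by-intersection (yes ∂I≤m) = ≤-trans (ih≤ I ∂I≤m ∣I∣<∣A∣ I-fragment) ∂I≤m
    by-intersection (no ∂I≰m)  = by-union ∂U<m (anyV? (λ x → ext U x Bool.≟ true))
      where
      ∂U<m : ∣ ∂ U ∣ < m
      ∂U<m = +-cancelˡ-< m _ _ (<-≤-trans (+-monoˡ-< ∣ ∂ U ∣ (≰⇒> ∂I≰m)) submodular)

  fragment-bound : HasFullRowRank H → SumFree → ∀ A → FragmentBound A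
  fragment-bound FR SF = lexicographic-induction FragmentBound (∣_∣ ∘ ∂) ∣_∣ by-shape
    where
    by-shape : ∀ A → (∀ B → ∣ ∂ B ∣ < ∣ ∂ A ∣ → FragmentBound B) →
                     (∀ B → ∣ ∂ B ∣ ≤ ∣ ∂ A ∣ → ∣ B ∣ < ∣ A ∣ → FragmentBound B) → FragmentBound A
    by-shape A ih< ih≤ with affinelyClosed-or-nonAffineTriple A
    ... | inj₁ closed = affine-fragment-bound FR SF closed
    ... | inj₂ triple = nonaffine-fragment-step triple ih< ih≤

  component : ∀ C {x} → C x ≡ false →
    ∃[ A ] (A x ≡ true × (∀ z → A z ≡ true → Reach H C x z) ×
            (∀ z → C z ≡ false → nbhd A z ≡ true → A z ≡ true))
  component C {x} x∉C = R j , x∈R j , R-reach j , λ z z∉C e → stable z (R-extend {j} z∉C e)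
    where
    R : ℕ → VSet r
    R zero    z = does (z ≟V x)
    R (suc k) z = R k z ∨ (not (C z) ∧ nbhd (R k) z)

    R-incr : ∀ k → R k ⊆ R (suc k)
    R-incr k z e rewrite e = refl

    R-extend : ∀ {k z} → C z ≡ false → nbhd (R k) z ≡ true → R (suc k) z ≡ true
    R-extend {k} {z} z∉C e rewrite z∉C | e = Bool.∨-zeroʳ (R k z)

    x∈R : ∀ k → R k x ≡ true
    x∈R zero    = dec-true (x ≟V x) refl
    x∈R (suc k) = R-incr k x (x∈R k)

    R-reach : ∀ k z → R k z ≡ true → Reach H C x z
    R-reach zero    z e with from-does (z ≟V x) e
    ... | refl = here x∉C
    R-reach (suc k) z e with R k z in Rkz
    ... | true  = R-reach k z Rkz
    ... | false with nbhd-elim (R k) (Bool.∧-conicalʳ (not (C z)) _ e)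
    ...   | i , p = reach-snoc (R-reach k (z ⊕ H i) p) (i , ⊕-cancel-outer z (H i))
                               (Bool.not-injective {y = false} (Bool.∧-conicalˡ _ _ e))

    j = proj₁ (increasing-stabilises R R-incr)
    stable = proj₂ (increasing-stabilises R R-incr)

  disconnected-fragment : ∀ {C} → Disconnected H C → ∃[ A ] (Fragment A × ∂ A ⊆ C)
  disconnected-fragment {C} (x , y , x∉C , y∉C , x⇝̸y) with component C x∉C
  ... | A , x∈A , reach , closed = A , ((x , x∈A) , (y , ext-intro A y∉A y∉nbhdA)) , ∂A⊆C
    where
    y∉A : A y ≡ false
    y∉A = Bool.¬-not λ y∈A → x⇝̸y (reach y y∈A)
    y∉nbhdA : nbhd A y ≡ false
    y∉nbhdA = Bool.¬-not λ e → Bool.not-¬ y∉A (closed y y∉C e)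
    ∂A⊆C : ∂ A ⊆ C
    ∂A⊆C z e with ∂-elim A e
    ... | z∉A , z∈nbhdA = Bool.¬-not λ z∉C → Bool.not-¬ z∉A (closed z z∉C z∈nbhdA)

  degree≡d : ∀ x → degree H x ≡ d
  degree≡d x = trans (length-filter≡count (Adj? H x) (allV r)) (∣∣-translate x inS)

  minDegree≡d : minDegree H ≡ d
  minDegree≡d = fold-min (allV r)
    where
    fold-min : ∀ xs → foldr (λ x m → degree H x ⊓ m) (degree H 𝟘) xs ≡ d
    fold-min []       = degree≡d 𝟘
    fold-min (x ∷ xs) rewrite degree≡d x | fold-min xs = ⊓-idem d

  𝟘∉S : (∀ i → H i ≢ 𝟘) → inS 𝟘 ≡ false
  𝟘∉S nonzero = dec-false (𝟘 ∈S? H) λ (i , 𝟘≡Hi) → nonzero i (sym 𝟘≡Hi)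

  reach-from-𝟘 : ∀ {a w} → Reach H inS a w → a ≡ 𝟘 → w ≡ 𝟘
  reach-from-𝟘 (here _) a≡𝟘 = a≡𝟘
  reach-from-𝟘 (step _ (i , 𝟘⊕b≡Hi) b⇝w) refl =
    contradiction (inS-intro i (trans (sym (⊕-identityˡ _)) 𝟘⊕b≡Hi)) (Bool.not-¬ (reach-start b⇝w))
    where
    reach-start : ∀ {a w} → Reach H inS a w → inS a ≡ false
    reach-start (here a∉S)     = a∉S
    reach-start (step a∉S _ _) = a∉S

  S-isCut : (∀ i → H i ≢ 𝟘) → IsCut H inS
  S-isCut nonzero with anyV? (λ y → (inS y Bool.≟ false) ×-dec (isZero y Bool.≟ false))
  ... | yes (y , y∉S , y≢𝟘) =
    inj₁ (𝟘 , y , 𝟘∉S nonzero , y∉S , λ 𝟘⇝y → Bool.not-¬ y≢𝟘 (dec-true (y ≟V 𝟘) (reach-from-𝟘 𝟘⇝y refl)))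
  ... | no ¬y = inj₂ (trans (remaining≡∣not∣ inS) (trans (count-cong only-𝟘 (allV r)) (∣isZero∣ r)))
    where
    only-𝟘 : not ∘ inS ≗ isZero
    only-𝟘 y with y ≟V 𝟘
    ... | yes refl = cong not (𝟘∉S nonzero)
    ... | no y≢𝟘  = cong not (Bool.¬-not λ y∉S → ¬y (y , y∉S , dec-false (y ≟V 𝟘) y≢𝟘))

  cut-bound : HasFullRowRank H → SumFree → (∀ i → H i ≢ 𝟘) → ∀ C → IsCut H C → d ≤ size C
  cut-bound FR SF nonzero C (inj₁ disconnected) with disconnected-fragment disconnected
  ... | A , frag , ∂A⊆C = ≤-trans (fragment-bound FR SF A frag)
                            (subst (∣ ∂ A ∣ ≤_) (sym (size≡∣∣ C)) (count-mono ∂A⊆C (allV r)))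
  cut-bound FR SF nonzero C (inj₂ one-left) = +-cancelʳ-≤ 1 d (size C) (begin
    d + 1                ≡⟨ cong (d +_) (∣isZero∣ r) ⟨
    d + ∣ isZero {r} ∣   ≤⟨ +-monoʳ-≤ d (count-mono 𝟘∉S′ (allV r)) ⟩
    d + ∣ not ∘ inS ∣    ≡⟨ ∣∣-complement inS ⟩
    ∣V∣ r                ≡⟨ ∣∣-complement C ⟨
    ∣ C ∣ + ∣ not ∘ C ∣  ≡⟨ cong₂ _+_ (size≡∣∣ C) (trans (sym one-left) (remaining≡∣not∣ C)) ⟨
    size C + 1           ∎)
    where
    open ≤-Reasoning
    𝟘∉S′ : isZero ⊆ not ∘ inS
    𝟘∉S′ y e with from-does (y ≟V 𝟘) e
    ... | refl = cong not (𝟘∉S nonzero)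

mainTheorem19 : (r n : ℕ) (H : Matrix r n) → r ≤ n → HasFullRowRank H
    → (∀ (i : Fin n) → H i ≢ 𝟘)
    → (∀ (i j k : Fin n) → H k ≢ (H i ⊕ H j))
    → IsVertexConnectivity H (minDegree H)
mainTheorem19 r n H _ FR nonzero SF =
  subst (IsVertexConnectivity H) (sym minDegree≡d)
    ((inS , S-isCut nonzero , size≡∣∣ inS) , cut-bound FR SF nonzero)
  where open CayleyGraph H
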